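{- Let $A$ be a pseudo-BCI algebra and let $d$ be a regular type II implicative derivation on $A$. Then $\mathrm{Ker}(d)=\mathrm{K}(A)$ if and only if $d(x)=\varphi_x$ for all $x\in A$.
   Context: A pseudo-BCI algebra is a structure $(A,\to,\rightsquigarrow,1)$ of type $(2,2,0)$ such that for all $x,y,z\in A$: $(x\to y)\rightsquigarrow[(y\to z)\rightsquigarrow(x\to z)]=1$; $(x\rightsquigarrow y)\to[(y\rightsquigarrow z)\to(x\rightsquigarrow z)]=1$; $1\to x=x$; $1\rightsquigarrow x=x$; and $x\to y=1$, $y\to x=1$ imply $x=y$. Write $x\le y$ iff $x\to y=1$. Put $x\Cup_1 y=(x\to y)\rightsquigarrow y$, $x\Cup_2 y=(x\rightsquigarrow y)\to y$, $\varphi_x=(x\to 1)\rightsquigarrow 1$, $\mathrm{K}(A)=\{x\in A\mid x\le 1\}$. A map $d:A\to A$ is a type II implicative derivation if $d(x\to y)=(d(x)\to y)\Cup_2(x\to d(y))$ and $d(x\rightsquigarrow y)=(d(x)\rightsquigarrow y)\Cup_1(x\rightsquigarrow d(y))$ for all $x,y$; it is regular if $d(1)=1$. $\mathrm{Ker}(d)=\{x\in A\mid d(x)=1\}$. -}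

module Defs where

open import Level using (Level; suc)
open import Relation.Binary.PropositionalEquality using (_≡_)
open import Data.Product using (_×_)

record PseudoBCI (a : Level) : Set (suc a) where
  infixr 5 _⇒_ _⇝_
  field
    Carrier : Set a
    _⇒_     : Carrier → Carrier → Carrier
    _⇝_     : Carrier → Carrier → Carrier
    𝟏       : Carrier
    ax1     : ∀ x y z → (x ⇒ y) ⇝ ((y ⇒ z) ⇝ (x ⇒ z)) ≡ 𝟏
    ax2     : ∀ x y z → (x ⇝ y) ⇒ ((y ⇝ z) ⇒ (x ⇝ z)) ≡ 𝟏
    ax3     : ∀ x → 𝟏 ⇒ x ≡ x
    ax4     : ∀ x → 𝟏 ⇝ x ≡ x
    ax5     : ∀ x y → x ⇒ y ≡ 𝟏 → y ⇒ x ≡ 𝟏 → x ≡ y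

  _≤_ : Carrier → Carrier → Set a
  x ≤ y = x ⇒ y ≡ 𝟏

  _⋓₁_ : Carrier → Carrier → Carrier
  x ⋓₁ y = (x ⇒ y) ⇝ y

  _⋓₂_ : Carrier → Carrier → Carrier
  x ⋓₂ y = (x ⇝ y) ⇒ y

  φ : Carrier → Carrier
  φ x = (x ⇒ 𝟏) ⇝ 𝟏

  InK : Carrier → Set a
  InK x = x ≤ 𝟏

  IsTypeIIImplicativeDerivation : (Carrier → Carrier) → Set a
  IsTypeIIImplicativeDerivation d =
    (∀ x y → d (x ⇒ y) ≡ ((d x ⇒ y) ⋓₂ (x ⇒ d y)))  ×
    (∀ x y → d (x ⇝ y) ≡ ((d x ⇝ y) ⋓₁ (x ⇝ d y)))

  IsRegular : (Carrier → Carrier) → Set a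
  IsRegular d = d 𝟏 ≡ 𝟏

  InKer : (Carrier → Carrier) → Carrier → Set a
  InKer d x = d x ≡ 𝟏

-- A regular type II derivation satisfies d x = x ⋓₂ d x, hence x ≤ d x, and its
-- fixed points are closed under ⇝ and satisfy d (y ⇒ u) = y ⇒ u and
-- d (u ⇒ x) = u ⇒ d x.  Since 1 is fixed, every φ x is fixed.  If K(A) ⊆ Ker(d),
-- then x ≤ φ x puts φ x ⇒ x in K(A), so 1 = d (φ x ⇒ x) = φ x ⇒ d x; that in
-- turn puts d x ⇒ φ x in K(A), so 1 = d (d x ⇒ φ x) = d x ⇒ φ x, and
-- antisymmetry gives d x = φ x.  Conversely φ x = 1 iff x ≤ 1.
module Submission where

open import Defs
open import Level using (Level)
open import Data.Product using (proj₁; proj₂)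
open import Function.Bundles using (_⇔_; mk⇔; Equivalence)
open import Relation.Binary.PropositionalEquality
  using (_≡_; sym; trans; cong; cong₂; subst; module ≡-Reasoning)

module PseudoBCIProperties {a : Level} (A : PseudoBCI a) where
  open PseudoBCI A

  ⇒-refl : ∀ x → x ≤ x
  ⇒-refl x with ax2 𝟏 𝟏 x
  ... | e rewrite ax4 𝟏 | ax4 x | ax3 (x ⇒ x) = e

  x⇝x⋓₁y≡𝟏 : ∀ x y → x ⇝ (x ⋓₁ y) ≡ 𝟏
  x⇝x⋓₁y≡𝟏 x y with ax1 𝟏 x y
  ... | e rewrite ax3 x | ax3 y = e

  ≤-⋓₂ : ∀ x y → x ≤ (x ⋓₂ y)
  ≤-⋓₂ x y with ax2 𝟏 x y
  ... | e rewrite ax4 x | ax4 y = e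

  ≤-to-⇝ : ∀ {x y} → x ≤ y → x ⇝ y ≡ 𝟏
  ≤-to-⇝ {x} {y} x≤y with x⇝x⋓₁y≡𝟏 x y
  ... | e rewrite x≤y | ax4 y = e

  ≤-from-⇝ : ∀ {x y} → x ⇝ y ≡ 𝟏 → x ≤ y
  ≤-from-⇝ {x} {y} x⇝y≡𝟏 with ≤-⋓₂ x y
  ... | e rewrite x⇝y≡𝟏 | ax3 y = e

  ≤-antisym : ∀ {x y} → x ≤ y → y ≤ x → x ≡ y
  ≤-antisym = ax5 _ _

  ⇒-antitoneˡ : ∀ {x y} z → x ≤ y → (y ⇒ z) ≤ (x ⇒ z)
  ⇒-antitoneˡ {x} {y} z x≤y with ax1 x y z
  ... | e rewrite x≤y | ax4 ((y ⇒ z) ⇝ (x ⇒ z)) = ≤-from-⇝ e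

  ⇒-monotoneʳ : ∀ {x y} z → x ≤ y → (z ⇒ x) ≤ (z ⇒ y)
  ⇒-monotoneʳ {x} {y} z x≤y with ax1 z x y
  ... | e rewrite x≤y | ax4 (z ⇒ y) = ≤-from-⇝ e

  ≤-φ : ∀ x → x ≤ φ x
  ≤-φ x = ≤-from-⇝ (x⇝x⋓₁y≡𝟏 x 𝟏)

  φ-of-K : ∀ {x} → InK x → φ x ≡ 𝟏
  φ-of-K {x} x≤𝟏 = trans (cong (_⇝ 𝟏) x≤𝟏) (ax4 𝟏)

  ⇒-converse-InK : ∀ {x y} → x ≤ y → InK (y ⇒ x)
  ⇒-converse-InK {x} {y} x≤y with ax1 y x y
  ... | e rewrite x≤y | ⇒-refl y | ax4 𝟏 = ≤-from-⇝ e

  ⋓₂-absorb : ∀ {x y} → x ≤ y → x ⋓₂ y ≡ y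
  ⋓₂-absorb {y = y} x≤y = trans (cong (_⇒ y) (≤-to-⇝ x≤y)) (ax3 y)

  ⋓₁-idem : ∀ x → x ⋓₁ x ≡ x
  ⋓₁-idem x = trans (cong (_⇝ x) (⇒-refl x)) (ax4 x)

module RegularTypeIIDerivation {a : Level} (A : PseudoBCI a) (d : PseudoBCI.Carrier A → PseudoBCI.Carrier A)
  (isDerivation : PseudoBCI.IsTypeIIImplicativeDerivation A d) (regular : PseudoBCI.IsRegular A d) where
  open PseudoBCI A
  open PseudoBCIProperties A
  open ≡-Reasoning

  d-⇒ : ∀ x y → d (x ⇒ y) ≡ (d x ⇒ y) ⋓₂ (x ⇒ d y)
  d-⇒ = proj₁ isDerivation

  d-⇝ : ∀ x y → d (x ⇝ y) ≡ (d x ⇝ y) ⋓₁ (x ⇝ d y)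
  d-⇝ = proj₂ isDerivation

  d≡x⋓₂dx : ∀ x → d x ≡ x ⋓₂ d x
  d≡x⋓₂dx x = begin
    d x                         ≡⟨ cong d (sym (ax3 x)) ⟩
    d (𝟏 ⇒ x)                   ≡⟨ d-⇒ 𝟏 x ⟩
    (d 𝟏 ⇒ x) ⋓₂ (𝟏 ⇒ d x)      ≡⟨ cong (λ t → (t ⇒ x) ⋓₂ (𝟏 ⇒ d x)) regular ⟩
    (𝟏 ⇒ x) ⋓₂ (𝟏 ⇒ d x)        ≡⟨ cong₂ _⋓₂_ (ax3 x) (ax3 (d x)) ⟩
    x ⋓₂ d x                    ∎

  ≤-d : ∀ x → x ≤ d x
  ≤-d x = subst (x ≤_) (sym (d≡x⋓₂dx x)) (≤-⋓₂ x (d x))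

  d-⇝-fixed : ∀ {u v} → d u ≡ u → d v ≡ v → d (u ⇝ v) ≡ u ⇝ v
  d-⇝-fixed {u} {v} du≡u dv≡v = begin
    d (u ⇝ v)                   ≡⟨ d-⇝ u v ⟩
    (d u ⇝ v) ⋓₁ (u ⇝ d v)      ≡⟨ cong (λ t → (t ⇝ v) ⋓₁ (u ⇝ d v)) du≡u ⟩
    (u ⇝ v) ⋓₁ (u ⇝ d v)        ≡⟨ cong (λ t → (u ⇝ v) ⋓₁ (u ⇝ t)) dv≡v ⟩
    (u ⇝ v) ⋓₁ (u ⇝ v)          ≡⟨ ⋓₁-idem (u ⇝ v) ⟩
    u ⇝ v                       ∎

  d-⇒-fixedʳ : ∀ {u} y → d u ≡ u → d (y ⇒ u) ≡ y ⇒ u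
  d-⇒-fixedʳ {u} y du≡u = begin
    d (y ⇒ u)                   ≡⟨ d-⇒ y u ⟩
    (d y ⇒ u) ⋓₂ (y ⇒ d u)      ≡⟨ cong (λ t → (d y ⇒ u) ⋓₂ (y ⇒ t)) du≡u ⟩
    (d y ⇒ u) ⋓₂ (y ⇒ u)        ≡⟨ ⋓₂-absorb (⇒-antitoneˡ u (≤-d y)) ⟩
    y ⇒ u                       ∎

  d-⇒-fixedˡ : ∀ {u} x → d u ≡ u → d (u ⇒ x) ≡ u ⇒ d x
  d-⇒-fixedˡ {u} x du≡u = begin
    d (u ⇒ x)                   ≡⟨ d-⇒ u x ⟩
    (d u ⇒ x) ⋓₂ (u ⇒ d x)      ≡⟨ cong (λ t → (t ⇒ x) ⋓₂ (u ⇒ d x)) du≡u ⟩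
    (u ⇒ x) ⋓₂ (u ⇒ d x)        ≡⟨ ⋓₂-absorb (⇒-monotoneʳ u (≤-d x)) ⟩
    u ⇒ d x                     ∎

  d-φ : ∀ x → d (φ x) ≡ φ x
  d-φ x = d-⇝-fixed (d-⇒-fixedʳ x regular) regular

  K⊆Ker⇒d≡φ : (∀ x → InK x → InKer d x) → ∀ x → d x ≡ φ x
  K⊆Ker⇒d≡φ K⊆Ker x = ≤-antisym dx≤φx φx≤dx
    where
    φx≤dx : φ x ≤ d x
    φx≤dx = trans (sym (d-⇒-fixedˡ x (d-φ x))) (K⊆Ker _ (⇒-converse-InK (≤-φ x)))

    dx≤φx : d x ≤ φ x
    dx≤φx = trans (sym (d-⇒-fixedʳ (d x) (d-φ x))) (K⊆Ker _ (⇒-converse-InK φx≤dx))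

  d≡φ⇒Ker≡K : (∀ x → d x ≡ φ x) → ∀ x → InKer d x ⇔ InK x
  d≡φ⇒Ker≡K d≡φ x = mk⇔ Ker⊆K K⊆Ker
    where
    Ker⊆K : InKer d x → InK x
    Ker⊆K dx≡𝟏 with ≤-φ x
    ... | e rewrite trans (sym (d≡φ x)) dx≡𝟏 = e

    K⊆Ker : InK x → InKer d x
    K⊆Ker x≤𝟏 = trans (d≡φ x) (φ-of-K x≤𝟏)

proposition3p14 : {a : Level} (A : PseudoBCI a) (d : PseudoBCI.Carrier A → PseudoBCI.Carrier A) →
    PseudoBCI.IsTypeIIImplicativeDerivation A d → PseudoBCI.IsRegular A d →
    ((∀ x → (PseudoBCI.InKer A d x ⇔ PseudoBCI.InK A x)) ⇔ (∀ x → d x ≡ PseudoBCI.φ A x))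
proposition3p14 A d isDerivation regular =
  mk⇔ (λ Ker≡K → K⊆Ker⇒d≡φ (λ x → Equivalence.from (Ker≡K x))) d≡φ⇒Ker≡K
  where open RegularTypeIIDerivation A d isDerivation regular
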